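{- For every prime number $p$ and every nonnegative integer $n$, $$R_p(n)\equiv\tau_{p-1}(n+1)\pmod p.$$
   Context: For a nonzero integer $k$, $\tau_k$ is defined by $q\prod_{m=1}^{\infty}(1-q^m)^k=\sum_{n=1}^{\infty}\tau_k(n)q^n$. For an integer $t\geq2$, $R_t(n)$ is the number of partitions of $n$ with no part divisible by $t$ (with $R_t(0)=1$). -}

module Defs where

open import Data.Nat as ℕ using (ℕ; zero; suc; _∸_; _≤?_)
open import Data.Nat.Divisibility using (_∣?_)
open import Data.Integer as ℤ using (ℤ; +_; -[1+_])
open import Data.List using (List; []; _∷_; [_]; map; concatMap; filter; length; upTo; foldr)
open import Data.List.Relation.Unary.All using (all?)
open import Relation.Nullary using (¬?)
open import Relation.Nullary.Decidable using (does)
open import Data.Bool using (if_then_else_)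

-- Formal power series over ℤ in q: coefficient functions ℕ → ℤ

Series : Set
Series = ℕ → ℤ

sumℤ : List ℤ → ℤ
sumℤ = foldr ℤ._+_ (+ 0)

_⊛_ : Series → Series → Series
(f ⊛ g) n = sumℤ (map (λ i → f i ℤ.* g (n ∸ i)) (upTo (suc n)))

one : Series
one zero    = + 1
one (suc _) = + 0

_^ₛ_ : Series → ℕ → Series
s ^ₛ zero  = one
s ^ₛ suc j = s ⊛ (s ^ₛ j)

-- the series 1 - q^m  (m ≥ 1)
oneMinusQ : ℕ → Series
oneMinusQ m zero = + 1
oneMinusQ m (suc n) = if does (suc n ℕ.≟ m) then ℤ.- (+ 1) else + 0

-- its inverse (1 - q^m)^{-1} = Σ_j q^{mj}  (m ≥ 1)
invOneMinusQ : ℕ → Series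
invOneMinusQ m n = if does (m ∣? n) then + 1 else + 0

factorPow : ℤ → ℕ → Series
factorPow (+ j)     m = oneMinusQ m ^ₛ j
factorPow -[1+ j ]  m = invOneMinusQ m ^ₛ suc j

prodUpTo : ℤ → ℕ → Series
prodUpTo k zero    = one
prodUpTo k (suc N) = factorPow k (suc N) ⊛ prodUpTo k N

-- τ_k(n): coefficient of q^n in q ∏_{m≥1} (1-q^m)^k.
-- The coefficient of q^n in the infinite product only depends on the
-- factors with m ≤ n (the others are ≡ 1 mod q^{n+1}), so the truncation
-- ∏_{m=1}^{n} computes it exactly.
τ : ℤ → ℕ → ℤ
τ k zero    = + 0
τ k (suc n) = prodUpTo k n n

-- partitionsFuel f n b : all partitions of n with all parts ≤ b
-- (written as nonincreasing lists), given fuel f ≥ n.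
partitionsFuel : ℕ → ℕ → ℕ → List (List ℕ)
partitionsFuel _       zero    _ = [ [] ]
partitionsFuel zero    (suc _) _ = []
partitionsFuel (suc f) (suc n) b =
  concatMap (λ a → map (a ∷_) (partitionsFuel f (suc n ∸ a) a))
            (filter (λ a → a ≤? suc n) (map suc (upTo b)))

partitions : ℕ → List (List ℕ)
partitions n = partitionsFuel n n n

R : ℕ → ℕ → ℕ
R t n = length (filter (λ λp → all? (λ a → ¬? (t ∣? a)) λp) (partitions n))

-- Modulo p, (1 - q^m)^p ≡ 1 - q^(mp) (the freshman's dream), so that
-- (1 - q^m)^(p-1) ≡ (1 - q^(mp)) / (1 - q^m).  In the product over m ≤ n, the numerators
-- 1 - q^(mp) with mp ≤ n cancel the denominators 1 - q^j with p ∣ j, leaving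
-- ∏_{m ≤ n, p ∤ m} 1 / (1 - q^m), whose coefficient of q^n is R_p(n), times the numerators
-- with mp > n, which do not affect the coefficient of q^n.  Both congruences are equalities
-- in a quotient ring Z[[q]]/(a), with a = p and a = q^(n+1).

module Submission where

open import Defs
open import Level using (_⊔_; 0ℓ)
open import Algebra.Bundles using (CommutativeSemiring; CommutativeRing; Semiring; Monoid; CommutativeMonoid)
open import Data.Bool using (true; false; if_then_else_)
open import Data.Empty using (⊥-elim)
open import Data.Fin as Fin using (Fin; toℕ; inject₁; fromℕ)
open import Data.Fin.Properties using (toℕ-inject₁; toℕ-fromℕ; toℕ<n)
open import Data.Integer as ℤ using (ℤ; +_)
import Data.Integer.Properties as ℤ
import Data.Integer.Divisibility.Signed as Signed
open import Data.List using (List; []; _∷_; [_]; _++_; map; filter; length; upTo; applyUpTo; concatMap)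
import Data.List.Properties as List
open import Data.List.Relation.Unary.All using (all?)
open import Data.Nat as ℕ using (ℕ; zero; suc; _∸_; _<_; _≤_; _≤?_; s≤s; z≤n; NonZero)
import Data.Nat.Properties as ℕ
open import Data.Nat.Combinatorics using (_C_; nC1≡n; nCn≡1; nCk+nC[k+1]≡[n+1]C[k+1])
open import Data.Nat.Divisibility as ℕ using (_∣?_; divides)
open import Data.Nat.Primality using (Prime; euclidsLemma)
open import Data.Product using (_,_; ∃-syntax; proj₁; proj₂)
open import Data.Sum using (inj₁; inj₂)
open import Function using (_∘_)
open import Relation.Nullary using (Dec; yes; no; ¬_; ¬?)
open import Relation.Nullary.Decidable using (does)
open import Relation.Binary.PropositionalEquality as ≡ using (_≡_; _≗_; cong; cong₂; subst)

[1+k]*[1+n]C[1+k]≡[1+n]*nCk : ∀ n k → suc k ℕ.* (suc n C suc k) ≡ suc n ℕ.* (n C k)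
[1+k]*[1+n]C[1+k]≡[1+n]*nCk zero    zero    = ≡.refl
[1+k]*[1+n]C[1+k]≡[1+n]*nCk zero    (suc k) = ℕ.*-zeroʳ (suc (suc k))
[1+k]*[1+n]C[1+k]≡[1+n]*nCk (suc n) zero    = begin
  1 ℕ.* (suc (suc n) C 1) ≡⟨ ℕ.*-identityˡ _ ⟩
  suc (suc n) C 1         ≡⟨ nC1≡n (suc (suc n)) ⟩
  suc (suc n)             ≡⟨ ℕ.*-identityʳ (suc (suc n)) ⟨
  suc (suc n) ℕ.* 1       ∎
  where open ≡.≡-Reasoning
[1+k]*[1+n]C[1+k]≡[1+n]*nCk (suc n) (suc k) = begin
  suc (suc k) ℕ.* (suc (suc n) C suc (suc k))
    ≡⟨ cong (suc (suc k) ℕ.*_) (nCk+nC[k+1]≡[n+1]C[k+1] (suc n) (suc k)) ⟨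
  suc (suc k) ℕ.* (x ℕ.+ w)
    ≡⟨ split k x w ⟩
  x ℕ.+ (suc k ℕ.* x ℕ.+ suc (suc k) ℕ.* w)
    ≡⟨ cong₂ (λ a b → x ℕ.+ (a ℕ.+ b)) ([1+k]*[1+n]C[1+k]≡[1+n]*nCk n k)
                                       ([1+k]*[1+n]C[1+k]≡[1+n]*nCk n (suc k)) ⟩
  x ℕ.+ (suc n ℕ.* (n C k) ℕ.+ suc n ℕ.* (n C suc k))
    ≡⟨ cong (λ a → a ℕ.+ (suc n ℕ.* (n C k) ℕ.+ suc n ℕ.* (n C suc k))) (nCk+nC[k+1]≡[n+1]C[k+1] n k) ⟨
  (n C k ℕ.+ n C suc k) ℕ.+ (suc n ℕ.* (n C k) ℕ.+ suc n ℕ.* (n C suc k))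
    ≡⟨ join n (n C k) (n C suc k) ⟩
  suc (suc n) ℕ.* (n C k ℕ.+ n C suc k)
    ≡⟨ cong (suc (suc n) ℕ.*_) (nCk+nC[k+1]≡[n+1]C[k+1] n k) ⟩
  suc (suc n) ℕ.* x ∎
  where
  open ≡.≡-Reasoning
  open import Data.Nat.Tactic.RingSolver using (solve-∀)
  x = suc n C suc k
  w = suc n C suc (suc k)
  split : ∀ k x w → suc (suc k) ℕ.* (x ℕ.+ w) ≡ x ℕ.+ (suc k ℕ.* x ℕ.+ suc (suc k) ℕ.* w)
  split = solve-∀
  join : ∀ n y z → (y ℕ.+ z) ℕ.+ (suc n ℕ.* y ℕ.+ suc n ℕ.* z) ≡ suc (suc n) ℕ.* (y ℕ.+ z)
  join = solve-∀

prime∣pCk : ∀ {p k} → Prime p → 0 < k → k < p → p ℕ.∣ p C k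
prime∣pCk {suc n} {suc k} pr _ k<p
  with euclidsLemma (suc k) (suc n C suc k) pr
         (divides (n C k) (≡.trans ([1+k]*[1+n]C[1+k]≡[1+n]*nCk n k) (ℕ.*-comm (suc n) (n C k))))
... | inj₁ p∣k  = ⊥-elim (ℕ.<⇒≱ k<p (ℕ.∣⇒≤ p∣k))
... | inj₂ p∣pCk = p∣pCk

module _ {c ℓ} (R : CommutativeSemiring c ℓ) where

  open CommutativeSemiring R
  open import Algebra.Definitions.RawSemiring rawSemiring using (_^_; _×_; sum)
  open import Algebra.Properties.CommutativeSemiring.Binomial R using (theorem; binomialTerm)
  open import Algebra.Properties.Monoid.Sum +-monoid using (sum-init-last; sum-cong-≋; sum-replicate-zero)
  open import Algebra.Properties.Monoid.Mult +-monoid using (×-homo-1; ×-assocˡ)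
  open import Relation.Binary.Reasoning.Setoid setoid

  [x+y]^p≈x^p+y^p : ∀ {p} → Prime p → (∀ x → p × x ≈ 0#) → ∀ x y → (x + y) ^ p ≈ x ^ p + y ^ p
  [x+y]^p≈x^p+y^p {suc q} pr char x y = begin
    (x + y) ^ p
      ≈⟨ theorem p x y ⟩
    t Fin.zero + sum (λ i → t (Fin.suc i))
      ≈⟨ +-congˡ (sum-init-last (λ i → t (Fin.suc i))) ⟩
    t Fin.zero + (sum {q} middle + t (Fin.suc (fromℕ q)))
      ≈⟨ +-congˡ (+-cong (sum-cong-≋ middle≈0) last≈x^p) ⟩
    t Fin.zero + (sum {q} (λ _ → 0#) + x ^ p)
      ≈⟨ +-cong first≈y^p (+-congʳ (sum-replicate-zero q)) ⟩
    y ^ p + (0# + x ^ p)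
      ≈⟨ +-congˡ (+-identityˡ (x ^ p)) ⟩
    y ^ p + x ^ p
      ≈⟨ +-comm (y ^ p) (x ^ p) ⟩
    x ^ p + y ^ p                                        ∎
    where
    p = suc q
    t : Fin (suc p) → Carrier
    t = binomialTerm x y p
    -- t k computes to term (toℕ k).
    term : ℕ → Carrier
    term j = (p C j) × (x ^ j * y ^ (p ℕ.∸ j))
    middle : Fin q → Carrier
    middle i = t (Fin.suc (inject₁ i))
    middle≈0 : ∀ i → middle i ≈ 0#
    middle≈0 i with prime∣pCk pr (s≤s z≤n) (s≤s (ℕ.≤-trans (s≤s (ℕ.≤-reflexive (toℕ-inject₁ i))) (toℕ<n i)))
    ... | divides m eq = begin
      (p C k) × w    ≡⟨ cong (_× w) (≡.trans eq (ℕ.*-comm m p)) ⟩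
      (p ℕ.* m) × w  ≈⟨ ×-assocˡ w p m ⟨
      p × (m × w)    ≈⟨ char (m × w) ⟩
      0#             ∎
      where
      k = suc (toℕ (inject₁ i))
      w = x ^ k * y ^ (p ℕ.∸ k)
    last≈x^p : t (Fin.suc (fromℕ q)) ≈ x ^ p
    last≈x^p = begin
      t (Fin.suc (fromℕ q))            ≡⟨ cong (λ k → term (suc k)) (toℕ-fromℕ q) ⟩
      (p C p) × (x ^ p * y ^ (p ℕ.∸ p)) ≡⟨ cong₂ (λ a b → a × (x ^ p * y ^ b)) (nCn≡1 p) (ℕ.n∸n≡0 p) ⟩
      1 × (x ^ p * 1#)                 ≈⟨ ×-homo-1 (x ^ p * 1#) ⟩
      x ^ p * 1#                       ≈⟨ *-identityʳ (x ^ p) ⟩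
      x ^ p                            ∎
    first≈y^p : t Fin.zero ≈ y ^ p
    first≈y^p = trans (×-homo-1 (1# * y ^ p)) (*-identityˡ (y ^ p))

module QuotientByPrincipalIdeal {c ℓ} (R : CommutativeRing c ℓ) (a : CommutativeRing.Carrier R) where

  open CommutativeRing R
  open import Algebra.Properties.Ring ring using (-‿distribʳ-*)
  open import Algebra.Properties.AbelianGroup +-abelianGroup using (⁻¹-∙-comm)
  open import Algebra.Properties.CommutativeSemigroup +-commutativeSemigroup using (interchange)
  open import Relation.Binary.Reasoning.Setoid setoid

  infix 4 _∼_
  _∼_ : Carrier → Carrier → Set (c ⊔ ℓ)
  x ∼ y = ∃[ z ] x ≈ y + a * z

  ≈⇒∼ : ∀ {x y} → x ≈ y → x ∼ y
  ≈⇒∼ {x} {y} x≈y = 0# , (begin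
    x           ≈⟨ x≈y ⟩
    y           ≈⟨ +-identityʳ y ⟨
    y + 0#      ≈⟨ +-congˡ (zeroʳ a) ⟨
    y + a * 0#  ∎)

  ∼-sym : ∀ {x y} → x ∼ y → y ∼ x
  ∼-sym {x} {y} (z , x≈y+az) = - z , (begin
    y                         ≈⟨ +-identityʳ y ⟨
    y + 0#                    ≈⟨ +-congˡ (-‿inverseʳ (a * z)) ⟨
    y + (a * z - a * z)       ≈⟨ +-assoc y (a * z) (- (a * z)) ⟨
    y + a * z - a * z         ≈⟨ +-cong (sym x≈y+az) (-‿distribʳ-* a z) ⟩
    x + a * - z               ∎)

  ∼-trans : ∀ {x y w} → x ∼ y → y ∼ w → x ∼ w
  ∼-trans {x} {y} {w} (z , x≈y+az) (z′ , y≈w+az′) = z′ + z , (begin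
    x                      ≈⟨ x≈y+az ⟩
    y + a * z              ≈⟨ +-congʳ y≈w+az′ ⟩
    w + a * z′ + a * z     ≈⟨ +-assoc w (a * z′) (a * z) ⟩
    w + (a * z′ + a * z)   ≈⟨ +-congˡ (distribˡ a z′ z) ⟨
    w + a * (z′ + z)       ∎)

  +-cong-∼ : ∀ {x y u v} → x ∼ y → u ∼ v → x + u ∼ y + v
  +-cong-∼ {x} {y} {u} {v} (z , x≈y+az) (z′ , u≈v+az′) = z + z′ , (begin
    x + u                      ≈⟨ +-cong x≈y+az u≈v+az′ ⟩
    (y + a * z) + (v + a * z′) ≈⟨ interchange y (a * z) v (a * z′) ⟩
    (y + v) + (a * z + a * z′) ≈⟨ +-congˡ (distribˡ a z z′) ⟨
    (y + v) + a * (z + z′)     ∎)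

  *-congʳ-∼ : ∀ {x y} u → x ∼ y → x * u ∼ y * u
  *-congʳ-∼ {x} {y} u (z , x≈y+az) = z * u , (begin
    x * u              ≈⟨ *-congʳ x≈y+az ⟩
    (y + a * z) * u    ≈⟨ distribʳ u y (a * z) ⟩
    y * u + a * z * u  ≈⟨ +-congˡ (*-assoc a z u) ⟩
    y * u + a * (z * u) ∎)

  *-cong-∼ : ∀ {x y u v} → x ∼ y → u ∼ v → x * u ∼ y * v
  *-cong-∼ {x} {y} {u} {v} x∼y u∼v =
    ∼-trans (*-congʳ-∼ u x∼y)
      (∼-trans (≈⇒∼ (*-comm y u)) (∼-trans (*-congʳ-∼ y u∼v) (≈⇒∼ (*-comm v y))))

  -‿cong-∼ : ∀ {x y} → x ∼ y → - x ∼ - y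
  -‿cong-∼ {x} {y} (z , x≈y+az) = - z , (begin
    - x              ≈⟨ -‿cong x≈y+az ⟩
    - (y + a * z)    ≈⟨ ⁻¹-∙-comm y (a * z) ⟨
    - y + - (a * z)  ≈⟨ +-congˡ (-‿distribʳ-* a z) ⟩
    - y + a * - z    ∎)

  a∼0 : a ∼ 0#
  a∼0 = 1# , (begin
    a           ≈⟨ *-identityʳ a ⟨
    a * 1#      ≈⟨ +-identityˡ (a * 1#) ⟨
    0# + a * 1# ∎)

  quotientRing : CommutativeRing c (c ⊔ ℓ)
  quotientRing = record
    { _≈_ = _∼_
    ; isCommutativeRing = record
      { isRing = record
        { +-isAbelianGroup = record
          { isGroup = record
            { isMonoid = record
              { isSemigroup = record
                { isMagma = record
                  { isEquivalence = record { refl = ≈⇒∼ refl ; sym = ∼-sym ; trans = ∼-trans }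
                  ; ∙-cong = +-cong-∼
                  }
                ; assoc = λ x y z → ≈⇒∼ (+-assoc x y z)
                }
              ; identity = (λ x → ≈⇒∼ (+-identityˡ x)) , (λ x → ≈⇒∼ (+-identityʳ x))
              }
            ; inverse = (λ x → ≈⇒∼ (-‿inverseˡ x)) , (λ x → ≈⇒∼ (-‿inverseʳ x))
            ; ⁻¹-cong = -‿cong-∼
            }
          ; comm = λ x y → ≈⇒∼ (+-comm x y)
          }
        ; *-cong = *-cong-∼
        ; *-assoc = λ x y z → ≈⇒∼ (*-assoc x y z)
        ; *-identity = (λ x → ≈⇒∼ (*-identityˡ x)) , (λ x → ≈⇒∼ (*-identityʳ x))
        ; distrib = (λ x y z → ≈⇒∼ (distribˡ x y z)) , (λ x y z → ≈⇒∼ (distribʳ x y z))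
        }
      ; *-comm = λ x y → ≈⇒∼ (*-comm x y)
      }
    }

  module Q = CommutativeRing quotientRing
  open import Algebra.Definitions.RawSemiring (Semiring.rawSemiring semiring) using (_×_; _^_)
  open import Algebra.Definitions.RawSemiring (Semiring.rawSemiring Q.semiring)
    using () renaming (_×_ to _×ᵩ_; _^_ to _^ᵩ_)

  -- _×_ and _^_ are defined from the whole raw structure, so those of the quotient agree with
  -- those of R only propositionally.
  ×ᵩ≡× : ∀ n x → n ×ᵩ x ≡ n × x
  ×ᵩ≡× zero    x = ≡.refl
  ×ᵩ≡× (suc n) x = ≡.cong (_+_ x) (×ᵩ≡× n x)

  ^ᵩ≡^ : ∀ x n → x ^ᵩ n ≡ x ^ n
  ^ᵩ≡^ x zero    = ≡.refl
  ^ᵩ≡^ x (suc n) = ≡.cong (x *_) (^ᵩ≡^ x n)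

module ModuloPrime {c ℓ} (R : CommutativeRing c ℓ) {p} (pr : Prime p) where

  open CommutativeRing R
  open import Algebra.Definitions.RawSemiring (Semiring.rawSemiring semiring) using (_×_; _^_)
  open import Algebra.Properties.Semiring.Mult semiring using (×-assoc-*; ×-congʳ)
  open QuotientByPrincipalIdeal R (p × 1#) public

  p×x∼0 : ∀ x → p × x ∼ 0#
  p×x∼0 x = ∼-trans (≈⇒∼ p×x≈p×1*x) (∼-trans (*-congʳ-∼ x a∼0) (≈⇒∼ (zeroˡ x)))
    where
    p×x≈p×1*x : p × x ≈ (p × 1#) * x
    p×x≈p×1*x = sym (trans (×-assoc-* p 1# x) (×-congʳ p (*-identityˡ x)))

  frobenius : ∀ x y → (x + y) ^ p ∼ x ^ p + y ^ p
  frobenius x y = ≡.subst₂ _∼_ (^ᵩ≡^ (x + y) p) (≡.cong₂ _+_ (^ᵩ≡^ x p) (^ᵩ≡^ y p))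
    ([x+y]^p≈x^p+y^p Q.commutativeSemiring pr (λ z → ≡.subst (_∼ 0#) (≡.sym (×ᵩ≡× p z)) (p×x∼0 z)) x y)

  [1-x]^p∼1-x^p : ∀ x → (1# - x) ^ p ∼ 1# - x ^ p
  [1-x]^p∼1-x^p x = begin
    y ^ p                      ≈⟨ ≈⇒∼ (+-identityʳ (y ^ p)) ⟨
    y ^ p + 0#                 ≈⟨ ≈⇒∼ (+-congˡ (-‿inverseʳ (x ^ p))) ⟨
    y ^ p + (x ^ p - x ^ p)    ≈⟨ ≈⇒∼ (+-assoc (y ^ p) (x ^ p) (- (x ^ p))) ⟨
    y ^ p + x ^ p - x ^ p      ≈⟨ Q.+-congʳ (frobenius y x) ⟨
    (y + x) ^ p - x ^ p        ≈⟨ ≈⇒∼ (+-congʳ (trans (^-congˡ p y+x≈1) 1^p≈1)) ⟩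
    1# - x ^ p                 ∎
    where
    open import Relation.Binary.Reasoning.Setoid Q.setoid
    open import Algebra.Properties.Semiring.Exp semiring using (^-congˡ; ^-assocʳ)
    y = 1# - x
    y+x≈1 : y + x ≈ 1#
    y+x≈1 = trans (+-assoc 1# (- x) x) (trans (+-congˡ (-‿inverseˡ x)) (+-identityʳ 1#))
    -- 1# is 1# ^ 0
    1^p≈1 : 1# ^ p ≈ 1#
    1^p≈1 = ^-assocʳ 1# 0 p

-- Parametrised by the bare operations, so that the products formed in a ring and in its
-- quotients are the same function.
module Product {a} {A : Set a} (_∙_ : A → A → A) (ε : A) where

  ∏ : ℕ → (ℕ → A) → A
  ∏ zero    f = ε
  ∏ (suc n) f = f (suc n) ∙ ∏ n f

  onMultiplesOf : ℕ → (ℕ → A) → ℕ → A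
  onMultiplesOf p f m = if does (p ∣? m) then f m else ε

  offMultiplesOf : ℕ → (ℕ → A) → ℕ → A
  offMultiplesOf p f m = if does (p ∣? m) then ε else f m

module MonoidProduct {c ℓ} (M : Monoid c ℓ) where

  open Monoid M
  open import Data.Nat using (_+_; _*_)
  open Product _∙_ ε public
  open import Relation.Binary.Reasoning.Setoid setoid

  ∏-cong : ∀ n {f g} → (∀ {m} → m < n → f (suc m) ≈ g (suc m)) → ∏ n f ≈ ∏ n g
  ∏-cong zero    f≈g = refl
  ∏-cong (suc n) f≈g = ∙-cong (f≈g (ℕ.n<1+n n)) (∏-cong n (f≈g ∘ ℕ.m<n⇒m<1+n))

  ∏-identity : ∀ n {f} → (∀ {m} → m < n → f (suc m) ≈ ε) → ∏ n f ≈ ε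
  ∏-identity zero    f≈ε = refl
  ∏-identity (suc n) f≈ε =
    trans (∙-cong (f≈ε (ℕ.n<1+n n)) (∏-identity n (f≈ε ∘ ℕ.m<n⇒m<1+n))) (identityˡ ε)

  ∏-+ : ∀ m n f → ∏ (m + n) f ≈ ∏ m (λ i → f (i + n)) ∙ ∏ n f
  ∏-+ zero    n f = sym (identityˡ (∏ n f))
  ∏-+ (suc m) n f = begin
    f (suc m + n) ∙ ∏ (m + n) f                            ≈⟨ ∙-congˡ (∏-+ m n f) ⟩
    f (suc m + n) ∙ (∏ m (λ i → f (i + n)) ∙ ∏ n f)        ≈⟨ assoc _ _ _ ⟨
    (f (suc m + n) ∙ ∏ m (λ i → f (i + n))) ∙ ∏ n f        ∎

  onMultiplesOf-∙-offMultiplesOf : ∀ p f m → onMultiplesOf p f m ∙ offMultiplesOf p f m ≈ f m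
  onMultiplesOf-∙-offMultiplesOf p f m with does (p ∣? m)
  ... | true  = identityʳ (f m)
  ... | false = identityˡ (f m)

  ∏-multiples : ∀ {p} .{{_ : NonZero p}} n f → (∀ m → ¬ p ℕ.∣ m → f m ≈ ε) →
                ∏ (n * p) f ≈ ∏ n (λ j → f (j * p))
  ∏-multiples             zero    f f≈ε = refl
  ∏-multiples {p@(suc q)} (suc n) f f≈ε = begin
    ∏ (p + n * p) f
      ≈⟨ ∏-+ p (n * p) f ⟩
    (f (p + n * p) ∙ ∏ q (λ i → f (i + n * p))) ∙ ∏ (n * p) f
      ≈⟨ ∙-cong (∙-congˡ (∏-identity q between≈ε)) (∏-multiples n f f≈ε) ⟩
    (f (p + n * p) ∙ ε) ∙ ∏ n (λ j → f (j * p))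
      ≈⟨ ∙-congʳ (identityʳ _) ⟩
    f (p + n * p) ∙ ∏ n (λ j → f (j * p))                    ∎
    where
    between≈ε : ∀ {i} → i < q → f (suc i + n * p) ≈ ε
    between≈ε {i} i<q = f≈ε (suc i + n * p) λ p∣ →
      ℕ.<⇒≱ (s≤s i<q) (ℕ.∣⇒≤ (ℕ.∣m+n∣m⇒∣n (subst (p ℕ.∣_) (ℕ.+-comm (suc i) (n * p)) p∣) (ℕ.n∣m*n n)))

  ∏-onMultiplesOf : ∀ {p} .{{_ : NonZero p}} n f → ∏ (n * p) (onMultiplesOf p f) ≈ ∏ n (λ j → f (j * p))
  ∏-onMultiplesOf {p} n f =
    trans (∏-multiples n (onMultiplesOf p f) offMultiple≈ε) (∏-cong n (λ {j} _ → onMultiple≈ (suc j)))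
    where
    offMultiple≈ε : ∀ m → ¬ p ℕ.∣ m → onMultiplesOf p f m ≈ ε
    offMultiple≈ε m p∤m with p ∣? m
    ... | yes p∣m = ⊥-elim (p∤m p∣m)
    ... | no  _   = refl
    onMultiple≈ : ∀ j → onMultiplesOf p f (j * p) ≈ f (j * p)
    onMultiple≈ j with p ∣? j * p
    ... | yes _     = refl
    ... | no  p∤j*p = ⊥-elim (p∤j*p (ℕ.n∣m*n j))

module CommutativeMonoidProduct {c ℓ} (M : CommutativeMonoid c ℓ) where

  open CommutativeMonoid M
  open MonoidProduct monoid public
  open import Algebra.Properties.CommutativeSemigroup commutativeSemigroup using (interchange)

  ∏-distrib : ∀ n f g → ∏ n (λ m → f m ∙ g m) ≈ ∏ n f ∙ ∏ n g
  ∏-distrib zero    f g = sym (identityˡ ε)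
  ∏-distrib (suc n) f g = trans (∙-congˡ (∏-distrib n f g)) (interchange _ _ _ _)

module CauchyProduct where

  open import Data.Integer using (_+_; _*_; -_)
  open ≡ using (refl; sym; trans)
  open ≡.≡-Reasoning
  open import Data.Integer.Tactic.RingSolver using (solve-∀)
  import Algebra.Construct.Pointwise ℕ as Pointwise

  -- The Cauchy product unrolled along the first factor: f ⊛ g = f 0 · g + q · ((f ∘ suc) ⊛ g).
  conv : Series → Series → Series
  conv f g zero    = f 0 * g 0
  conv f g (suc n) = f 0 * g (suc n) + conv (f ∘ suc) g n

  ⊛≗conv : ∀ f g → f ⊛ g ≗ conv f g
  ⊛≗conv f g zero    = ℤ.+-identityʳ (f 0 * g 0)
  ⊛≗conv f g (suc n) = begin
    (f ⊛ g) (suc n)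
      ≡⟨ cong sumℤ (List.map-upTo (λ i → f i * g (suc n ∸ i)) (suc (suc n))) ⟩
    f 0 * g (suc n) + sumℤ (applyUpTo (λ i → f (suc i) * g (n ∸ i)) (suc n))
      ≡⟨ cong (λ xs → f 0 * g (suc n) + sumℤ xs) (List.map-upTo (λ i → f (suc i) * g (n ∸ i)) (suc n)) ⟨
    f 0 * g (suc n) + ((f ∘ suc) ⊛ g) n
      ≡⟨ cong (_+_ (f 0 * g (suc n))) (⊛≗conv (f ∘ suc) g n) ⟩
    conv f g (suc n) ∎

  conv-cong : ∀ {f f′ g g′} → f ≗ f′ → g ≗ g′ → conv f g ≗ conv f′ g′
  conv-cong f≗f′ g≗g′ zero    = cong₂ _*_ (f≗f′ 0) (g≗g′ 0)
  conv-cong f≗f′ g≗g′ (suc n) =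
    cong₂ _+_ (cong₂ _*_ (f≗f′ 0) (g≗g′ (suc n))) (conv-cong (f≗f′ ∘ suc) g≗g′ n)

  conv-distribʳ : ∀ f f′ g n → conv (λ k → f k + f′ k) g n ≡ conv f g n + conv f′ g n
  conv-distribʳ f f′ g zero    = ℤ.*-distribʳ-+ (g 0) (f 0) (f′ 0)
  conv-distribʳ f f′ g (suc n) = begin
    (f 0 + f′ 0) * g (suc n) + conv (λ k → f (suc k) + f′ (suc k)) g n
      ≡⟨ cong (_+_ ((f 0 + f′ 0) * g (suc n))) (conv-distribʳ (f ∘ suc) (f′ ∘ suc) g n) ⟩
    (f 0 + f′ 0) * g (suc n) + (conv (f ∘ suc) g n + conv (f′ ∘ suc) g n)
      ≡⟨ rearrange (f 0) (f′ 0) (g (suc n)) _ _ ⟩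
    conv f g (suc n) + conv f′ g (suc n) ∎
    where
    rearrange : ∀ a b c x y → (a + b) * c + (x + y) ≡ (a * c + x) + (b * c + y)
    rearrange = solve-∀

  conv-scaleˡ : ∀ c f g n → conv (λ k → c * f k) g n ≡ c * conv f g n
  conv-scaleˡ c f g zero    = ℤ.*-assoc c (f 0) (g 0)
  conv-scaleˡ c f g (suc n) = begin
    c * f 0 * g (suc n) + conv (λ k → c * f (suc k)) g n
      ≡⟨ cong (_+_ (c * f 0 * g (suc n))) (conv-scaleˡ c (f ∘ suc) g n) ⟩
    c * f 0 * g (suc n) + c * conv (f ∘ suc) g n
      ≡⟨ factor c (f 0) (g (suc n)) _ ⟩
    c * conv f g (suc n) ∎
    where
    factor : ∀ c a b x → c * a * b + c * x ≡ c * (a * b + x)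
    factor = solve-∀

  conv-oneˡ : ∀ g → conv one g ≗ g
  conv-oneˡ g zero    = ℤ.*-identityˡ (g 0)
  conv-oneˡ g (suc n) = begin
    + 1 * g (suc n) + conv (λ _ → + 0) g n  ≡⟨ cong (_+_ (+ 1 * g (suc n))) (conv-zeroˡ n) ⟩
    + 1 * g (suc n) + + 0                   ≡⟨ ℤ.+-identityʳ _ ⟩
    + 1 * g (suc n)                         ≡⟨ ℤ.*-identityˡ (g (suc n)) ⟩
    g (suc n)                               ∎
    where
    conv-zeroˡ : ∀ n → conv (λ _ → + 0) g n ≡ + 0
    conv-zeroˡ zero    = refl
    conv-zeroˡ (suc n) = trans (ℤ.+-identityˡ _) (conv-zeroˡ n)

  conv-comm : ∀ n f g → conv f g n ≡ conv g f n
  conv-comm zero          f g = ℤ.*-comm (f 0) (g 0)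
  conv-comm (suc zero)    f g = swap (f 0) (f 1) (g 0) (g 1)
    where
    swap : ∀ a b c d → a * d + b * c ≡ c * b + d * a
    swap = solve-∀
  conv-comm (suc (suc n)) f g = begin
    f 0 * g (2+ n) + conv (f ∘ suc) g (suc n)
      ≡⟨ cong (_+_ (f 0 * g (2+ n))) (conv-comm (suc n) (f ∘ suc) g) ⟩
    f 0 * g (2+ n) + (g 0 * f (2+ n) + conv (g ∘ suc) (f ∘ suc) n)
      ≡⟨ cong (λ x → f 0 * g (2+ n) + (g 0 * f (2+ n) + x)) (conv-comm n (g ∘ suc) (f ∘ suc)) ⟩
    f 0 * g (2+ n) + (g 0 * f (2+ n) + conv (f ∘ suc) (g ∘ suc) n)
      ≡⟨ swap (f 0) (g (2+ n)) (g 0) (f (2+ n)) _ ⟩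
    g 0 * f (2+ n) + (f 0 * g (2+ n) + conv (f ∘ suc) (g ∘ suc) n)
      ≡⟨ cong (_+_ (g 0 * f (2+ n))) (conv-comm (suc n) (g ∘ suc) f) ⟨
    g 0 * f (2+ n) + conv (g ∘ suc) f (suc n) ∎
    where
    2+ : ℕ → ℕ
    2+ n = suc (suc n)
    swap : ∀ a b c d x → a * b + (c * d + x) ≡ c * d + (a * b + x)
    swap = solve-∀

  conv-assoc : ∀ n f g h → conv (conv f g) h n ≡ conv f (conv g h) n
  conv-assoc zero    f g h = ℤ.*-assoc (f 0) (g 0) (h 0)
  conv-assoc (suc n) f g h = begin
    conv f g 0 * h (suc n) + conv (λ k → f 0 * g (suc k) + conv (f ∘ suc) g k) h n
      ≡⟨ cong (_+_ (conv f g 0 * h (suc n))) (conv-distribʳ _ _ h n) ⟩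
    conv f g 0 * h (suc n) + (conv (λ k → f 0 * g (suc k)) h n + conv (conv (f ∘ suc) g) h n)
      ≡⟨ cong₂ (λ x y → conv f g 0 * h (suc n) + (x + y))
               (conv-scaleˡ (f 0) (g ∘ suc) h n) (conv-assoc n (f ∘ suc) g h) ⟩
    f 0 * g 0 * h (suc n) + (f 0 * conv (g ∘ suc) h n + conv (f ∘ suc) (conv g h) n)
      ≡⟨ factor (f 0) (g 0) (h (suc n)) _ _ ⟩
    conv f (conv g h) (suc n) ∎
    where
    factor : ∀ a b c x y → a * b * c + (a * x + y) ≡ a * (b * c + x) + y
    factor = solve-∀

  ⊛-cong : ∀ {f f′ g g′} → f ≗ f′ → g ≗ g′ → f ⊛ g ≗ f′ ⊛ g′
  ⊛-cong {f} {f′} {g} {g′} f≗f′ g≗g′ n =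
    trans (⊛≗conv f g n) (trans (conv-cong f≗f′ g≗g′ n) (sym (⊛≗conv f′ g′ n)))

  ⊛-comm : ∀ f g → f ⊛ g ≗ g ⊛ f
  ⊛-comm f g n = trans (⊛≗conv f g n) (trans (conv-comm n f g) (sym (⊛≗conv g f n)))

  ⊛-assoc : ∀ f g h → (f ⊛ g) ⊛ h ≗ f ⊛ (g ⊛ h)
  ⊛-assoc f g h n = begin
    ((f ⊛ g) ⊛ h) n     ≡⟨ ⊛≗conv (f ⊛ g) h n ⟩
    conv (f ⊛ g) h n    ≡⟨ conv-cong (⊛≗conv f g) (λ _ → refl) n ⟩
    conv (conv f g) h n ≡⟨ conv-assoc n f g h ⟩
    conv f (conv g h) n ≡⟨ conv-cong (λ _ → refl) (⊛≗conv g h) n ⟨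
    conv f (g ⊛ h) n    ≡⟨ ⊛≗conv f (g ⊛ h) n ⟨
    (f ⊛ (g ⊛ h)) n     ∎

  ⊛-identityˡ : ∀ f → one ⊛ f ≗ f
  ⊛-identityˡ f n = trans (⊛≗conv one f n) (conv-oneˡ f n)

  ⊛-distribʳ : ∀ h f g → (λ k → f k + g k) ⊛ h ≗ λ k → (f ⊛ h) k + (g ⊛ h) k
  ⊛-distribʳ h f g n = begin
    ((λ k → f k + g k) ⊛ h) n       ≡⟨ ⊛≗conv _ h n ⟩
    conv (λ k → f k + g k) h n      ≡⟨ conv-distribʳ f g h n ⟩
    conv f h n + conv g h n         ≡⟨ cong₂ _+_ (⊛≗conv f h n) (⊛≗conv g h n) ⟨
    (f ⊛ h) n + (g ⊛ h) n           ∎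

  seriesRing : CommutativeRing 0ℓ 0ℓ
  seriesRing = record
    { Carrier = Series
    ; _≈_ = _≗_
    ; _+_ = λ f g n → f n + g n
    ; _*_ = _⊛_
    ; -_ = λ f n → - f n
    ; 0# = λ _ → + 0
    ; 1# = one
    ; isCommutativeRing = record
      { isRing = record
        { +-isAbelianGroup = Pointwise.isAbelianGroup ℤ.+-0-isAbelianGroup
        ; *-cong = ⊛-cong
        ; *-assoc = ⊛-assoc
        ; *-identity = ⊛-identityˡ , λ f n → trans (⊛-comm f one n) (⊛-identityˡ f n)
        ; distrib = (λ h f g n → trans (⊛-comm h (λ k → f k + g k) n) (trans (⊛-distribʳ h f g n)
                                    (cong₂ _+_ (⊛-comm f h n) (⊛-comm g h n))))
                  , ⊛-distribʳ
        }
      ; *-comm = ⊛-comm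
      }
    }

open CauchyProduct using (seriesRing; conv; ⊛≗conv; conv-cong; conv-oneˡ)

module PowerSeries where

  open ≡ using (refl)
  open CommutativeRing seriesRing hiding (refl)
  open import Algebra.Definitions.RawSemiring (Semiring.rawSemiring semiring) using (_^_; _×_)
  open import Algebra.Properties.Semiring.Mult semiring using (×-assoc-*; ×-congʳ)
  open CommutativeMonoidProduct *-commutativeMonoid

  q : Series
  q zero          = + 0
  q (suc zero)    = + 1
  q (suc (suc _)) = + 0

  shift : ℕ → Series → Series
  shift zero    f         = f
  shift (suc m) f zero    = + 0
  shift (suc m) f (suc k) = shift m f k

  shift-< : ∀ {m k} f → k < m → shift m f k ≡ + 0
  shift-< {suc m} {zero}  f _         = refl
  shift-< {suc m} {suc k} f (s≤s k<m) = shift-< f k<m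

  shift-≥ : ∀ {m k} f → m ≤ k → shift m f k ≡ f (k ∸ m)
  shift-≥ {zero}          f _         = refl
  shift-≥ {suc m} {suc k} f (s≤s m≤k) = shift-≥ f m≤k

  q*≗shift : ∀ f → q * f ≗ shift 1 f
  q*≗shift f zero    = ⊛≗conv q f 0
  q*≗shift f (suc k) = begin
    (q * f) (suc k)                         ≡⟨ ⊛≗conv q f (suc k) ⟩
    + 0 ℤ.+ conv (λ i → q (suc i)) f k      ≡⟨ ℤ.+-identityˡ _ ⟩
    conv (λ i → q (suc i)) f k              ≡⟨ conv-cong q∘suc≗one (λ _ → refl) k ⟩
    conv one f k                            ≡⟨ conv-oneˡ f k ⟩
    f k                                     ∎
    where
    open ≡.≡-Reasoning
    q∘suc≗one : (λ i → q (suc i)) ≗ one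
    q∘suc≗one zero    = refl
    q∘suc≗one (suc _) = refl

  q^*≗shift : ∀ m f → q ^ m * f ≗ shift m f
  q^*≗shift zero    f k = *-identityˡ f k
  q^*≗shift (suc m) f zero    = ≡.trans (*-assoc q (q ^ m) f 0) (q*≗shift (q ^ m * f) 0)
  q^*≗shift (suc m) f (suc k) =
    ≡.trans (*-assoc q (q ^ m) f (suc k)) (≡.trans (q*≗shift (q ^ m * f) (suc k)) (q^*≗shift m f k))

  -- Stated with ≡ᵇ because does (suc k ℕ.≟ suc m), in oneMinusQ, computes to k ℕ.≡ᵇ m.
  shift-one : ∀ m k → shift m one k ≡ (if k ℕ.≡ᵇ m then + 1 else + 0)
  shift-one zero    zero    = refl
  shift-one zero    (suc k) = refl
  shift-one (suc m) zero    = refl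
  shift-one (suc m) (suc k) = shift-one m k

  q^≗shift : ∀ m → q ^ m ≗ shift m one
  q^≗shift m k = ≡.trans (≡.sym (*-identityʳ (q ^ m) k)) (q^*≗shift m one k)

  oneMinusQ≗1-q^ : ∀ m → oneMinusQ (suc m) ≗ 1# - q ^ suc m
  oneMinusQ≗1-q^ m k = ≡.trans (coefficient k) (cong (λ c → one k ℤ.- c) (≡.sym (q^≗shift (suc m) k)))
    where
    coefficient : ∀ k → oneMinusQ (suc m) k ≡ one k ℤ.- shift (suc m) one k
    coefficient zero    = refl
    coefficient (suc k) rewrite shift-one m k with k ℕ.≡ᵇ m
    ... | true  = refl
    ... | false = refl

  invOneMinusQ-∣ : ∀ {m k} → m ℕ.∣ k → invOneMinusQ m k ≡ + 1
  invOneMinusQ-∣ {m} {k} m∣k with m ∣? k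
  ... | yes _   = refl
  ... | no  m∤k = ⊥-elim (m∤k m∣k)

  invOneMinusQ-∤ : ∀ {m k} → ¬ m ℕ.∣ k → invOneMinusQ m k ≡ + 0
  invOneMinusQ-∤ {m} {k} m∤k with m ∣? k
  ... | yes m∣k = ⊥-elim (m∤k m∣k)
  ... | no  _   = refl

  invOneMinusQ-∸ : ∀ {m k} → m ≤ k → invOneMinusQ m k ≡ invOneMinusQ m (k ∸ m)
  invOneMinusQ-∸ {m} {k} m≤k with m ∣? k
  ... | yes m∣k = ≡.sym (invOneMinusQ-∣ (ℕ.∣m+n∣m⇒∣n (subst (m ℕ.∣_) (≡.sym (ℕ.m+[n∸m]≡n m≤k)) m∣k) ℕ.∣-refl))
  ... | no  m∤k = ≡.sym (invOneMinusQ-∤ (λ m∣k∸m → m∤k (ℕ.∣m∸n∣n⇒∣m m m≤k m∣k∸m ℕ.∣-refl)))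

  invOneMinusQ≈1+q^*invOneMinusQ : ∀ m → invOneMinusQ (suc m) ≈ 1# + q ^ suc m * invOneMinusQ (suc m)
  invOneMinusQ≈1+q^*invOneMinusQ m k =
    ≡.trans (coefficient k) (cong (ℤ._+_ (one k)) (≡.sym (q^*≗shift (suc m) G k)))
    where
    G = invOneMinusQ (suc m)
    coefficient : ∀ k → G k ≡ one k ℤ.+ shift (suc m) G k
    coefficient zero    = invOneMinusQ-∣ (suc m ℕ.∣0)
    coefficient (suc k) with suc k ℕ.<? suc m
    ... | yes k<m rewrite shift-< G k<m = invOneMinusQ-∤ (λ m∣k → ℕ.<⇒≱ k<m (ℕ.∣⇒≤ m∣k))
    ... | no  k≮m rewrite shift-≥ G (ℕ.≮⇒≥ k≮m) = ≡.trans (invOneMinusQ-∸ (ℕ.≮⇒≥ k≮m)) (≡.sym (ℤ.+-identityˡ _))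

  oneMinusQ*invOneMinusQ≈1 : ∀ m → oneMinusQ (suc m) * invOneMinusQ (suc m) ≈ 1#
  oneMinusQ*invOneMinusQ≈1 m = begin
    oneMinusQ (suc m) * G       ≈⟨ *-congʳ {G} (oneMinusQ≗1-q^ m) ⟩
    (1# - x) * G                ≈⟨ distribʳ G 1# (- x) ⟩
    1# * G + - x * G            ≈⟨ +-cong (*-identityˡ G) (sym (-‿distribˡ-* x G)) ⟩
    G - x * G                   ≈⟨ +-congʳ (invOneMinusQ≈1+q^*invOneMinusQ m) ⟩
    1# + x * G - x * G          ≈⟨ +-assoc 1# (x * G) (- (x * G)) ⟩
    1# + (x * G - x * G)        ≈⟨ +-congˡ {1#} (-‿inverseʳ (x * G)) ⟩
    1# + 0#                     ≈⟨ +-identityʳ 1# ⟩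
    1#                          ∎
    where
    open import Relation.Binary.Reasoning.Setoid setoid
    open import Algebra.Properties.Ring ring using (-‿distribˡ-*)
    x = q ^ suc m
    G = invOneMinusQ (suc m)

  invOneMinusQ*-unfold : ∀ m g → invOneMinusQ (suc m) * g ≈ g + q ^ suc m * (invOneMinusQ (suc m) * g)
  invOneMinusQ*-unfold m g = begin
    G * g                   ≈⟨ *-congʳ {g} (invOneMinusQ≈1+q^*invOneMinusQ m) ⟩
    (1# + x * G) * g        ≈⟨ distribʳ g 1# (x * G) ⟩
    1# * g + x * G * g      ≈⟨ +-cong (*-identityˡ g) (*-assoc x G g) ⟩
    g + x * (G * g)         ∎
    where
    open import Relation.Binary.Reasoning.Setoid setoid
    x = q ^ suc m
    G = invOneMinusQ (suc m)

  partitionSeries : ℕ → ℕ → Series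
  partitionSeries t b = ∏ b (offMultiplesOf t invOneMinusQ)

  withLargestPart : ℕ → ℕ → ℕ → ℤ
  withLargestPart t b k = if does (t ∣? suc b) then + 0 else shift (suc b) (partitionSeries t (suc b)) k

  partitionSeries-suc : ∀ t b k → partitionSeries t (suc b) k ≡ partitionSeries t b k ℤ.+ withLargestPart t b k
  partitionSeries-suc t b k with t ∣? suc b
  ... | yes _ = ≡.trans (*-identityˡ (partitionSeries t b) k) (≡.sym (ℤ.+-identityʳ _))
  ... | no  _ =
    ≡.trans (invOneMinusQ*-unfold b H k) (cong (ℤ._+_ (H k)) (q^*≗shift (suc b) (invOneMinusQ (suc b) ⊛ H) k))
    where H = partitionSeries t b

  partitionSeries-zero : ∀ t b → partitionSeries t b 0 ≡ + 1
  partitionSeries-zero t zero    = refl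
  partitionSeries-zero t (suc b) = begin
    partitionSeries t (suc b) 0
      ≡⟨ ⊛≗conv (offMultiplesOf t invOneMinusQ (suc b)) (partitionSeries t b) 0 ⟩
    offMultiplesOf t invOneMinusQ (suc b) 0 ℤ.* partitionSeries t b 0
      ≡⟨ cong₂ ℤ._*_ factor-zero (partitionSeries-zero t b) ⟩
    + 1                                                          ∎
    where
    open ≡.≡-Reasoning
    factor-zero : offMultiplesOf t invOneMinusQ (suc b) 0 ≡ + 1
    factor-zero with does (t ∣? suc b)
    ... | true  = refl
    ... | false = invOneMinusQ-∣ (suc b ℕ.∣0)

  count : ℕ → List (List ℕ) → ℕ
  count t = length ∘ filter (all? (λ a → ¬? (t ∣? a)))

  count-++ : ∀ t xss yss → count t (xss ++ yss) ≡ count t xss ℕ.+ count t yss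
  count-++ t xss yss = ≡.trans (cong length (List.filter-++ _ xss yss)) (List.length-++ (filter _ xss))

  count-map-∷-∣ : ∀ {t a} xss → t ℕ.∣ a → count t (map (a ∷_) xss) ≡ 0
  count-map-∷-∣ {t} {a} []          t∣a = refl
  count-map-∷-∣ {t} {a} (xs ∷ xss) t∣a with t ∣? a
  ... | yes _   = count-map-∷-∣ xss t∣a
  ... | no  t∤a = ⊥-elim (t∤a t∣a)

  count-map-∷-∤ : ∀ {t a} xss → ¬ t ℕ.∣ a → count t (map (a ∷_) xss) ≡ count t xss
  count-map-∷-∤ {t} {a} []          t∤a = refl
  count-map-∷-∤ {t} {a} (xs ∷ xss) t∤a with t ∣? a
  ... | yes t∣a = ⊥-elim (t∤a t∣a)
  ... | no  _ with does (all? (λ a → ¬? (t ∣? a)) xs)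
  ...   | true  = cong suc (count-map-∷-∤ xss t∤a)
  ...   | false = count-map-∷-∤ xss t∤a

  partsWithLargest : ℕ → ℕ → ℕ → List (List ℕ)
  partsWithLargest f n a = map (a ∷_) (partitionsFuel f (n ∸ a) a)

  count-partitionsFuel-suc : ∀ t f n b → count t (partitionsFuel (suc f) (suc n) (suc b)) ≡
    count t (partitionsFuel (suc f) (suc n) b) ℕ.+
    count t (concatMap (partsWithLargest f (suc n)) (filter (_≤? suc n) [ suc b ]))
  count-partitionsFuel-suc t f n b = begin
    count t (concatMap G (filter P (map suc (upTo (suc b)))))
      ≡⟨ cong (λ as → count t (concatMap G (filter P as))) parts≡ ⟩
    count t (concatMap G (filter P (map suc (upTo b) ++ [ suc b ])))
      ≡⟨ cong (count t ∘ concatMap G) (List.filter-++ P (map suc (upTo b)) [ suc b ]) ⟩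
    count t (concatMap G (filter P (map suc (upTo b)) ++ filter P [ suc b ]))
      ≡⟨ cong (count t) (List.concatMap-++ G (filter P (map suc (upTo b))) (filter P [ suc b ])) ⟩
    count t (concatMap G (filter P (map suc (upTo b))) ++ concatMap G (filter P [ suc b ]))
      ≡⟨ count-++ t (concatMap G (filter P (map suc (upTo b)))) (concatMap G (filter P [ suc b ])) ⟩
    count t (partitionsFuel (suc f) (suc n) b) ℕ.+ count t (concatMap G (filter P [ suc b ])) ∎
    where
    open ≡.≡-Reasoning
    G = partsWithLargest f (suc n)
    P = _≤? suc n
    parts≡ : map suc (upTo (suc b)) ≡ map suc (upTo b) ++ [ suc b ]
    parts≡ = ≡.trans (cong (map suc) (≡.sym (List.upTo-∷ʳ b))) (List.map-++ suc (upTo b) [ b ])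

  count-partsWithLargest : ∀ t f n b →
    (∀ {m} → m ≤ f → + count t (partitionsFuel f m (suc b)) ≡ partitionSeries t (suc b) m) → n ≤ f →
    + count t (concatMap (partsWithLargest f (suc n)) (filter (_≤? suc n) [ suc b ])) ≡ withLargestPart t b (suc n)
  count-partsWithLargest t f n b count≡ n≤f = count-largest
    where
    open ≡.≡-Reasoning
    H = partitionSeries t (suc b)
    -- Matching on a Dec argument: `with t ∣? suc b` would also rewrite the test hidden inside H.
    accepted : (t∣?b : Dec (t ℕ.∣ suc b)) → suc b ≤ suc n →
      + count t (partsWithLargest f (suc n) (suc b)) ≡ (if does t∣?b then + 0 else shift (suc b) H (suc n))
    accepted (yes t∣b) _         = cong +_ (count-map-∷-∣ (partitionsFuel f (n ∸ b) (suc b)) t∣b)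
    accepted (no  t∤b) (s≤s b≤n) = begin
      + count t (partsWithLargest f (suc n) (suc b))
        ≡⟨ cong +_ (count-map-∷-∤ (partitionsFuel f (n ∸ b) (suc b)) t∤b) ⟩
      + count t (partitionsFuel f (n ∸ b) (suc b))
        ≡⟨ count≡ (ℕ.≤-trans (ℕ.m∸n≤m n b) n≤f) ⟩
      H (n ∸ b)
        ≡⟨ shift-≥ H (s≤s b≤n) ⟨
      shift (suc b) H (suc n)                          ∎
    rejected : (t∣?b : Dec (t ℕ.∣ suc b)) → ¬ suc b ≤ suc n →
      + 0 ≡ (if does t∣?b then + 0 else shift (suc b) H (suc n))
    rejected (yes _) _   = refl
    rejected (no  _) b≮n = ≡.sym (shift-< H (ℕ.≰⇒> b≮n))
    count-largest : + count t (concatMap (partsWithLargest f (suc n)) (filter (_≤? suc n) [ suc b ])) ≡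
                    withLargestPart t b (suc n)
    count-largest with suc b ≤? suc n
    ... | yes b<n rewrite List.filter-accept (_≤? suc n) {xs = []} b<n
                        | List.++-identityʳ (partsWithLargest f (suc n) (suc b)) = accepted (t ∣? suc b) b<n
    ... | no  b≮n rewrite List.filter-reject (_≤? suc n) {xs = []} b≮n = rejected (t ∣? suc b) b≮n

  count-partitionsFuel : ∀ t f n b → n ≤ f → + count t (partitionsFuel f n b) ≡ partitionSeries t b n
  count-partitionsFuel t f       zero    b _         = ≡.sym (partitionSeries-zero t b)
  count-partitionsFuel t (suc f) (suc n) b (s≤s n≤f) = go b
    where
    open ≡.≡-Reasoning
    go : ∀ b → + count t (partitionsFuel (suc f) (suc n) b) ≡ partitionSeries t b (suc n)
    go zero    = refl
    go (suc b) = begin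
      + count t (partitionsFuel (suc f) (suc n) (suc b))
        ≡⟨ cong +_ (count-partitionsFuel-suc t f n b) ⟩
      + (count t (partitionsFuel (suc f) (suc n) b) ℕ.+ count t largest)
        ≡⟨ ℤ.pos-+ (count t (partitionsFuel (suc f) (suc n) b)) (count t largest) ⟩
      + count t (partitionsFuel (suc f) (suc n) b) ℤ.+ + count t largest
        ≡⟨ cong₂ ℤ._+_ (go b) (count-partsWithLargest t f n b (count-partitionsFuel t f _ (suc b)) n≤f) ⟩
      partitionSeries t b (suc n) ℤ.+ withLargestPart t b (suc n)
        ≡⟨ partitionSeries-suc t b (suc n) ⟨
      partitionSeries t (suc b) (suc n)                                  ∎
      where largest = concatMap (partsWithLargest f (suc n)) (filter (_≤? suc n) [ suc b ])

  R≡partitionSeries : ∀ t n → + R t n ≡ partitionSeries t n n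
  R≡partitionSeries t n = count-partitionsFuel t n n n ℕ.≤-refl

  ^ₛ≡^ : ∀ f n → f ^ₛ n ≡ f ^ n
  ^ₛ≡^ f zero    = refl
  ^ₛ≡^ f (suc n) = cong (f *_) (^ₛ≡^ f n)

  prodUpTo≡∏ : ∀ k n → prodUpTo k n ≡ ∏ n (factorPow k)
  prodUpTo≡∏ k zero    = refl
  prodUpTo≡∏ k (suc n) = cong (factorPow k (suc n) *_) (prodUpTo≡∏ k n)

  ×-coefficient : ∀ n f k → (n × f) k ≡ + n ℤ.* f k
  ×-coefficient zero    f k = refl
  ×-coefficient (suc n) f k = begin
    f k ℤ.+ (n × f) k          ≡⟨ cong (ℤ._+_ (f k)) (×-coefficient n f k) ⟩
    f k ℤ.+ + n ℤ.* f k        ≡⟨ ℤ.suc-* (+ n) (f k) ⟨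
    + suc n ℤ.* f k            ∎
    where open ≡.≡-Reasoning

  module _ (p-1 : ℕ) where

    private
      p = suc p-1

    -- Each factor 1 - q^m with p ∣ m ≤ n cancels against its inverse; the remaining
    -- numerators have n < m ≤ n p.
    ∏[1-q^mp]/[1-q^m]≈ : ∀ n →
      ∏ n (λ m → oneMinusQ (m ℕ.* p) * invOneMinusQ m) ≈
      ∏ (n ℕ.* p-1) (λ i → onMultiplesOf p oneMinusQ (i ℕ.+ n)) * partitionSeries p n
    ∏[1-q^mp]/[1-q^m]≈ n = begin
      ∏ n (λ m → oneMinusQ (m ℕ.* p) * G m)
        ≈⟨ ∏-distrib n (λ m → oneMinusQ (m ℕ.* p)) G ⟩
      ∏ n (λ m → oneMinusQ (m ℕ.* p)) * ∏ n G
        ≈⟨ *-cong (sym (∏-onMultiplesOf n oneMinusQ)) ∏G-split ⟩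
      ∏ (n ℕ.* p) E * (D * H)
        ≈⟨ *-congʳ {D * H} ∏E-split ⟩
      (T * ∏ n E) * (D * H)
        ≈⟨ *-assoc T (∏ n E) (D * H) ⟩
      T * (∏ n E * (D * H))
        ≈⟨ *-congˡ {T} (sym (*-assoc (∏ n E) D H)) ⟩
      T * (∏ n E * D * H)
        ≈⟨ *-congˡ {T} (*-congʳ {H} (sym (∏-distrib n E (onMultiplesOf p G)))) ⟩
      T * (∏ n (λ m → E m * onMultiplesOf p G m) * H)
        ≈⟨ *-congˡ {T} (*-congʳ {H} (∏-identity n cancel)) ⟩
      T * (1# * H)
        ≈⟨ *-congˡ {T} (*-identityˡ H) ⟩
      T * H                                     ∎
      where
      open import Relation.Binary.Reasoning.Setoid setoid
      G = invOneMinusQ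
      E = onMultiplesOf p oneMinusQ
      H = partitionSeries p n
      T = ∏ (n ℕ.* p-1) (λ i → E (i ℕ.+ n))
      D = ∏ n (onMultiplesOf p G)
      ∏G-split : ∏ n G ≈ D * H
      ∏G-split = trans (∏-cong n (λ {m} _ → sym (onMultiplesOf-∙-offMultiplesOf p G (suc m))))
                       (∏-distrib n (onMultiplesOf p G) (offMultiplesOf p G))
      ∏E-split : ∏ (n ℕ.* p) E ≈ T * ∏ n E
      ∏E-split = trans (reflexive (cong (λ k → ∏ k E) (≡.trans (ℕ.*-suc n p-1) (ℕ.+-comm n (n ℕ.* p-1)))))
                       (∏-+ (n ℕ.* p-1) n E)
      cancel : ∀ {m} → m < n → E (suc m) * onMultiplesOf p G (suc m) ≈ 1#
      cancel {m} _ with does (p ℕ.∣? suc m)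
      ... | true  = oneMinusQ*invOneMinusQ≈1 m
      ... | false = *-identityˡ 1#

  module _ {p-1 : ℕ} (pr : Prime (suc p-1)) where

    private
      p = suc p-1
      module Modp = ModuloPrime seriesRing pr
      open Modp using (_∼_; ≈⇒∼)
      open CommutativeMonoidProduct Modp.Q.*-commutativeMonoid using () renaming (∏-cong to ∏-cong-∼)

    [1-q^m]^[p-1]∼[1-q^mp]/[1-q^m] : ∀ m →
      oneMinusQ (suc m) ^ₛ p-1 ∼ oneMinusQ (suc m ℕ.* p) * invOneMinusQ (suc m)
    [1-q^m]^[p-1]∼[1-q^mp]/[1-q^m] m = begin
      y ^ₛ p-1                        ≡⟨ ^ₛ≡^ y p-1 ⟩
      y ^ p-1                         ≈⟨ ≈⇒∼ (sym (*-identityʳ (y ^ p-1))) ⟩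
      y ^ p-1 * 1#                    ≈⟨ ≈⇒∼ (*-congˡ {y ^ p-1} (sym (oneMinusQ*invOneMinusQ≈1 m))) ⟩
      y ^ p-1 * (y * G)               ≈⟨ ≈⇒∼ (sym (*-assoc (y ^ p-1) y G)) ⟩
      y ^ p-1 * y * G                 ≈⟨ ≈⇒∼ (*-congʳ {G} (*-comm (y ^ p-1) y)) ⟩
      y ^ p * G                       ≈⟨ Modp.*-congʳ-∼ {y ^ p} {oneMinusQ (suc m ℕ.* p)} G y^p∼ ⟩
      oneMinusQ (suc m ℕ.* p) * G     ∎
      where
      open import Relation.Binary.Reasoning.Setoid Modp.Q.setoid
      open import Algebra.Properties.Semiring.Exp semiring using (^-congˡ; ^-assocʳ)
      y = oneMinusQ (suc m)
      G = invOneMinusQ (suc m)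
      x = q ^ suc m
      y^p∼ : y ^ p ∼ oneMinusQ (suc m ℕ.* p)
      y^p∼ = begin
        y ^ p                    ≈⟨ ≈⇒∼ (^-congˡ p (oneMinusQ≗1-q^ m)) ⟩
        (1# - x) ^ p             ≈⟨ Modp.[1-x]^p∼1-x^p x ⟩
        1# - x ^ p               ≈⟨ ≈⇒∼ (+-congˡ {1#} (-‿cong (^-assocʳ q (suc m) p))) ⟩
        1# - q ^ (suc m ℕ.* p)   ≈⟨ ≈⇒∼ (sym (oneMinusQ≗1-q^ (p-1 ℕ.+ m ℕ.* p))) ⟩
        oneMinusQ (suc m ℕ.* p)  ∎

    prodUpTo∼ : ∀ n → prodUpTo (+ p-1) n ∼
      ∏ (n ℕ.* p-1) (λ i → onMultiplesOf p oneMinusQ (i ℕ.+ n)) * partitionSeries p n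
    prodUpTo∼ n = begin
      prodUpTo (+ p-1) n
        ≡⟨ prodUpTo≡∏ (+ p-1) n ⟩
      ∏ n (factorPow (+ p-1))
        ≈⟨ ∏-cong-∼ n (λ {m} _ → [1-q^m]^[p-1]∼[1-q^mp]/[1-q^m] m) ⟩
      ∏ n (λ m → oneMinusQ (m ℕ.* p) * invOneMinusQ m)
        ≈⟨ ≈⇒∼ (∏[1-q^mp]/[1-q^m]≈ p-1 n) ⟩
      ∏ (n ℕ.* p-1) (λ i → onMultiplesOf p oneMinusQ (i ℕ.+ n)) * partitionSeries p n ∎
      where open import Relation.Binary.Reasoning.Setoid Modp.Q.setoid

  module _ (p n : ℕ) where

    private
      module Modq = QuotientByPrincipalIdeal seriesRing (q ^ suc n)
      open Modq using (_∼_)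
      open CommutativeMonoidProduct Modq.Q.*-commutativeMonoid using () renaming (∏-identity to ∏-identity-∼)

    oneMinusQ∼1 : ∀ {m} → n < m → oneMinusQ m ∼ 1#
    oneMinusQ∼1 {suc m} (s≤s n≤m) = - q ^ (m ∸ n) , (begin
      oneMinusQ (suc m)                      ≈⟨ oneMinusQ≗1-q^ m ⟩
      1# - q ^ suc m                         ≈⟨ +-congˡ {1#} (-‿cong q^sucm≈) ⟩
      1# - q ^ suc n * q ^ (m ∸ n)           ≈⟨ +-congˡ {1#} (-‿distribʳ-* (q ^ suc n) (q ^ (m ∸ n))) ⟩
      1# + q ^ suc n * - q ^ (m ∸ n)         ∎)
      where
      open import Relation.Binary.Reasoning.Setoid setoid
      open import Algebra.Properties.Semiring.Exp semiring using (^-homo-*)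
      open import Algebra.Properties.Ring ring using (-‿distribʳ-*)
      q^sucm≈ : q ^ suc m ≈ q ^ suc n * q ^ (m ∸ n)
      q^sucm≈ = trans (reflexive (cong (λ k → q ^ suc k) (≡.sym (ℕ.m+[n∸m]≡n n≤m)))) (^-homo-* q (suc n) (m ∸ n))

    coefficient-∼ : ∀ {x y} → x ∼ y → x n ≡ y n
    coefficient-∼ {x} {y} (z , x≈y+q^z) = begin
      x n                                  ≡⟨ x≈y+q^z n ⟩
      y n ℤ.+ (q ^ suc n * z) n            ≡⟨ cong (ℤ._+_ (y n)) (q^*≗shift (suc n) z n) ⟩
      y n ℤ.+ shift (suc n) z n            ≡⟨ cong (ℤ._+_ (y n)) (shift-< z (ℕ.n<1+n n)) ⟩
      y n ℤ.+ + 0                          ≡⟨ ℤ.+-identityʳ (y n) ⟩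
      y n                                  ∎
      where open ≡.≡-Reasoning

    ∏-onMultiplesOf-beyond∼1 : ∀ t → ∏ t (λ i → onMultiplesOf p oneMinusQ (i ℕ.+ n)) ∼ 1#
    ∏-onMultiplesOf-beyond∼1 t = ∏-identity-∼ t factor∼1
      where
      factor∼1 : ∀ {i} → i < t → onMultiplesOf p oneMinusQ (suc i ℕ.+ n) ∼ 1#
      factor∼1 {i} _ with does (p ∣? suc i ℕ.+ n)
      ... | true  = oneMinusQ∼1 (s≤s (ℕ.m≤n+m n i))
      ... | false = Modq.Q.refl

    ∏-onMultiplesOf-beyond*-coefficient : ∀ t f →
      (∏ t (λ i → onMultiplesOf p oneMinusQ (i ℕ.+ n)) * f) n ≡ f n
    ∏-onMultiplesOf-beyond*-coefficient t f =
      coefficient-∼ {T * f} {f} (Modq.∼-trans {T * f} {1# * f} {f}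
        (Modq.*-congʳ-∼ {T} {1#} f (∏-onMultiplesOf-beyond∼1 t)) (Modq.≈⇒∼ {1# * f} {f} (*-identityˡ f)))
      where T = ∏ t (λ i → onMultiplesOf p oneMinusQ (i ℕ.+ n))

  ×1#*-coefficient : ∀ n f k → ((n × 1#) * f) k ≡ + n ℤ.* f k
  ×1#*-coefficient n f k = ≡.trans (trans (×-assoc-* n 1# f) (×-congʳ n (*-identityˡ f)) k) (×-coefficient n f k)

  prodUpTo-coefficient : ∀ {p-1} → Prime (suc p-1) → ∀ n →
    ∃[ z ] prodUpTo (+ p-1) n n ≡ partitionSeries (suc p-1) n n ℤ.+ + suc p-1 ℤ.* z
  prodUpTo-coefficient {p-1} pr n = z n , (begin
    prodUpTo (+ p-1) n n
      ≡⟨ S≈TH+pz n ⟩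
    (T * H) n ℤ.+ ((p × 1#) * z) n
      ≡⟨ cong₂ ℤ._+_ (∏-onMultiplesOf-beyond*-coefficient p n (n ℕ.* p-1) H) (×1#*-coefficient p z n) ⟩
    H n ℤ.+ + p ℤ.* z n                      ∎)
    where
    open ≡.≡-Reasoning
    p = suc p-1
    H = partitionSeries p n
    T = ∏ (n ℕ.* p-1) (λ i → onMultiplesOf p oneMinusQ (i ℕ.+ n))
    z : Series
    z = proj₁ (prodUpTo∼ pr n)
    S≈TH+pz : prodUpTo (+ p-1) n ≈ T * H + (p × 1#) * z
    S≈TH+pz = proj₂ (prodUpTo∼ pr n)

open PowerSeries using (partitionSeries; R≡partitionSeries; prodUpTo-coefficient)
open import Data.Integer using (_-_)
open import Data.Integer.Divisibility using (_∣_)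

mainTheorem19 : (p : ℕ) → Prime p → (n : ℕ) →
    (+ p) ∣ ((+ R p n) - τ (+ (p ∸ 1)) (suc n))
mainTheorem19 p@(suc p-1) pr n =
  Signed.∣⇒∣ᵤ (subst (+ p Signed.∣_) difference (Signed.∣m⇒∣-m (Signed.∣m⇒∣m*n z Signed.∣-refl)))
  where
  open import Data.Integer using (_+_; _*_; -_)
  open ≡.≡-Reasoning
  open import Data.Integer.Tactic.RingSolver using (solve-∀)
  H z : ℤ
  H = partitionSeries p n n
  z = proj₁ (prodUpTo-coefficient pr n)
  τ≡H+pz : τ (+ p-1) (suc n) ≡ H + + p * z
  τ≡H+pz = proj₂ (prodUpTo-coefficient pr n)
  cancel : ∀ h x → - x ≡ h - (h + x)
  cancel = solve-∀
  difference : - (+ p * z) ≡ + R p n - τ (+ p-1) (suc n)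
  difference = begin
    - (+ p * z)                   ≡⟨ cancel H (+ p * z) ⟩
    H - (H + + p * z)             ≡⟨ cong₂ _-_ (≡.sym (R≡partitionSeries p n)) (≡.sym τ≡H+pz) ⟩
    + R p n - τ (+ p-1) (suc n)   ∎
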